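{- For every integer $n \geq 4$, $$|E(\mathcal{R}_n)| = |E(\mathcal{R}_{n-1})| + |E(\mathcal{R}_{n-2})| + f_{n-1} + f_{n-3}.$$
   Context: A binary string is called run-constrained if every run (maximal block) of consecutive $1$s in it is immediately followed by a run of $0$s of strictly greater length. For $n \geq 1$, the Fibonacci-run graph $\mathcal{R}_n$ has vertex set $\{ w \in \{0,1\}^n : w00 \text{ is a run-constrained string of length } n+2\}$, and two vertices are adjacent iff they differ in exactly one coordinate. Fibonacci numbers: $f_0 = 0$, $f_1 = 1$, $f_n = f_{n-1} + f_{n-2}$. -}

module Defs where

open import Data.Bool using (Bool; true; false; _∧_; if_then_else_)
open import Data.Nat using (ℕ; zero; suc; _+_; _<ᵇ_; _≡ᵇ_)
open import Data.List using (List; []; _∷_; length; filter; map; concatMap; _++_)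
open import Data.Product using (_×_; _,_)
open import Data.Vec using (Vec; []; _∷_; toList)
open import Relation.Nullary.Decidable using (Dec)
open import Relation.Binary.PropositionalEquality using (_≡_)
open import Data.Bool.Properties using (_≟_)

fib : ℕ → ℕ
fib zero = 0
fib (suc zero) = 1
fib (suc (suc n)) = fib (suc n) + fib n

-- Run-length encoding: list of (bit, length ≥ 1) of the maximal runs, left to right.
runs : List Bool → List (Bool × ℕ)
runs [] = []
runs (b ∷ w) with runs w
... | [] = (b , 1) ∷ []
... | (c , k) ∷ rs = if (b ∧ c) ∨' (not' b ∧ not' c) then (c , suc k) ∷ rs else (b , 1) ∷ (c , k) ∷ rs
  where
  not' : Bool → Bool
  not' true = false
  not' false = true
  _∨'_ : Bool → Bool → Bool
  true ∨' _ = true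
  false ∨' y = y

runsOK : List (Bool × ℕ) → Bool
runsOK [] = true
runsOK ((false , _) ∷ rs) = runsOK rs
runsOK ((true , k) ∷ []) = false
runsOK ((true , k) ∷ (false , m) ∷ rs) = (k <ᵇ m) ∧ runsOK ((false , m) ∷ rs)
runsOK ((true , k) ∷ (true , m) ∷ rs) = false   -- impossible for maximal runs

RunConstrained : List Bool → Set
RunConstrained w = runsOK (runs w) ≡ true

runConstrained? : (w : List Bool) → Dec (RunConstrained w)
runConstrained? w = runsOK (runs w) ≟ true

allWords : (n : ℕ) → List (Vec Bool n)
allWords zero = [] ∷ []
allWords (suc n) = map (false ∷_) (allWords n) ++ map (true ∷_) (allWords n)

IsVertex : {n : ℕ} → Vec Bool n → Set
IsVertex w = RunConstrained (toList w ++ false ∷ false ∷ [])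

vertices : (n : ℕ) → List (Vec Bool n)
vertices n = filter (λ w → runConstrained? (toList w ++ false ∷ false ∷ [])) (allWords n)

hamming : {n : ℕ} → Vec Bool n → Vec Bool n → ℕ
hamming [] [] = 0
hamming (a ∷ u) (b ∷ v) = (if eqb a b then 0 else 1) + hamming u v
  where
  eqb : Bool → Bool → Bool
  eqb true true = true
  eqb false false = true
  eqb _ _ = false

pairs : {A : Set} → List A → List (A × A)
pairs [] = []
pairs (x ∷ xs) = map (x ,_) xs ++ pairs xs

edges : (n : ℕ) → List (Vec Bool n × Vec Bool n)
edges n = filter (λ { (u , v) → hamming u v Data.Nat.≟ 1 }) (pairs (vertices n))

numEdges : ℕ → ℕ
numEdges n = length (edges n)

-- Whether w00 is run-constrained is decided by a finite automaton reading w left to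
-- right, whose state records the length of the current run of ones, or how many more
-- zeros the current run of zeros still owes.  Splitting the cube on the first coordinate,
-- the edges among words accepted from a state s are those accepted from its two
-- successors plus one edge 0u–1u per word u accepted from both.  Vertex counts from
-- the start state are Fibonacci numbers, and on words one letter longer the states
-- `ones (k+1)` and `zeros (k+1)` count edges exactly like `ones k` and `zeros k`; with
-- these facts two unfoldings of the edge recurrence from the start state close up.

module Submission where

open import Defs
open import Data.Bool using (Bool; true; false; _∧_; if_then_else_)
open import Data.Bool.Properties using (∧-zeroʳ)
import Data.Bool.Properties as Bool
open import Data.List using (List; []; _∷_; length; filter; map; _++_)
open import Data.Nat using (ℕ; zero; suc; _+_; _∸_; _≤_; _<ᵇ_; _≡ᵇ_; z≤n; s≤s)
import Data.Nat as ℕ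
open import Data.Nat.Properties using (+-suc; +-identityʳ; m≤n+m)
open import Data.Nat.Solver using (module +-*-Solver)
open import Data.Product using (_×_; _,_)
import Data.Product as Product
open import Data.Vec using (Vec; []; _∷_; toList)
open import Data.Empty using (⊥-elim)
open import Function using (_∘_)
open import Relation.Nullary using (does)
open import Relation.Unary using (Decidable)
open import Relation.Binary.PropositionalEquality
  using (_≡_; _≢_; _≗_; refl; sym; trans; cong; cong₂)
open Relation.Binary.PropositionalEquality.≡-Reasoning
open +-*-Solver using (solve; _:+_; _:=_)

count : {X : Set} → (X → Bool) → List X → ℕ
count p []       = 0
count p (x ∷ xs) = if p x then suc (count p xs) else count p xs

count-++ : {X : Set} (p : X → Bool) (xs ys : List X) →
           count p (xs ++ ys) ≡ count p xs + count p ys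
count-++ p []       ys = refl
count-++ p (x ∷ xs) ys with p x
... | true  = cong suc (count-++ p xs ys)
... | false = count-++ p xs ys

count-map : {X Y : Set} (p : Y → Bool) (f : X → Y) (xs : List X) →
            count p (map f xs) ≡ count (p ∘ f) xs
count-map p f []       = refl
count-map p f (x ∷ xs) with p (f x)
... | true  = cong suc (count-map p f xs)
... | false = count-map p f xs

count-≗ : {X : Set} {p q : X → Bool} → p ≗ q → (xs : List X) → count p xs ≡ count q xs
count-≗ p≗q []       = refl
count-≗ {p = p} {q} p≗q (x ∷ xs) with p x | q x | p≗q x
... | true  | .true  | refl = cong suc (count-≗ p≗q xs)
... | false | .false | refl = count-≗ p≗q xs

count-none : {X : Set} {p : X → Bool} → (∀ x → p x ≡ false) → (xs : List X) → count p xs ≡ 0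
count-none none []       = refl
count-none {p = p} none (x ∷ xs) with p x | none x
... | .false | refl = count-none none xs

length-filter : {X : Set} {P : X → Set} (P? : Decidable P) (xs : List X) →
                length (filter P? xs) ≡ count (does ∘ P?) xs
length-filter P? []       = refl
length-filter P? (x ∷ xs) with does (P? x)
... | true  = cong suc (length-filter P? xs)
... | false = length-filter P? xs

count-filter : {X : Set} {P : X → Set} (P? : Decidable P) (q : X → Bool) (xs : List X) →
               count q (filter P? xs) ≡ count (λ x → does (P? x) ∧ q x) xs
count-filter P? q []       = refl
count-filter P? q (x ∷ xs) with does (P? x)
... | false = count-filter P? q xs
... | true with q x
...   | true  = cong suc (count-filter P? q xs)
...   | false = count-filter P? q xs

within : {X : Set} → (X → Bool) → (X × X → Bool) → X × X → Bool
within p q (u , v) = p u ∧ p v ∧ q (u , v)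

cross : {X : Set} → (X × X → Bool) → List X → List X → ℕ
cross q []       ys = 0
cross q (x ∷ xs) ys = count (λ y → q (x , y)) ys + cross q xs ys

count-pairs-filter : {X : Set} {P : X → Set} (P? : Decidable P) (q : X × X → Bool) (xs : List X) →
                     count q (pairs (filter P? xs)) ≡ count (within (does ∘ P?) q) (pairs xs)
count-pairs-filter P? q []       = refl
count-pairs-filter P? q (x ∷ xs) with does (P? x) in Px
... | true = begin
  count q (map (x ,_) (filter P? xs) ++ pairs (filter P? xs))
    ≡⟨ count-++ q (map (x ,_) (filter P? xs)) (pairs (filter P? xs)) ⟩
  count q (map (x ,_) (filter P? xs)) + count q (pairs (filter P? xs))
    ≡⟨ cong₂ _+_ (trans (count-map q (x ,_) (filter P? xs)) (count-filter P? (λ y → q (x , y)) xs))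
                 (count-pairs-filter P? q xs) ⟩
  count (λ y → does (P? y) ∧ q (x , y)) xs + count (within (does ∘ P?) q) (pairs xs)
    ≡⟨ cong (_+ _) (count-≗ (λ y → cong (_∧ (does (P? y) ∧ q (x , y))) (sym Px)) xs) ⟩
  count (within (does ∘ P?) q ∘ (x ,_)) xs + count (within (does ∘ P?) q) (pairs xs)
    ≡⟨ cong (_+ _) (sym (count-map _ (x ,_) xs)) ⟩
  count (within (does ∘ P?) q) (map (x ,_) xs) + count (within (does ∘ P?) q) (pairs xs)
    ≡⟨ sym (count-++ _ (map (x ,_) xs) (pairs xs)) ⟩
  count (within (does ∘ P?) q) (map (x ,_) xs ++ pairs xs) ∎
... | false = begin
  count q (pairs (filter P? xs))
    ≡⟨ count-pairs-filter P? q xs ⟩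
  count (within (does ∘ P?) q) (pairs xs)
    ≡⟨ cong (_+ _) (sym (trans (count-map _ (x ,_) xs) (count-none (λ y → cong (_∧ (does (P? y) ∧ q (x , y))) Px) xs))) ⟩
  count (within (does ∘ P?) q) (map (x ,_) xs) + count (within (does ∘ P?) q) (pairs xs)
    ≡⟨ sym (count-++ _ (map (x ,_) xs) (pairs xs)) ⟩
  count (within (does ∘ P?) q) (map (x ,_) xs ++ pairs xs) ∎

count-pairs-++ : {X : Set} (q : X × X → Bool) (xs ys : List X) →
                 count q (pairs (xs ++ ys)) ≡ count q (pairs xs) + count q (pairs ys) + cross q xs ys
count-pairs-++ q []       ys = sym (+-identityʳ _)
count-pairs-++ q (x ∷ xs) ys = begin
  count q (map (x ,_) (xs ++ ys) ++ pairs (xs ++ ys))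
    ≡⟨ count-++ q (map (x ,_) (xs ++ ys)) (pairs (xs ++ ys)) ⟩
  count q (map (x ,_) (xs ++ ys)) + count q (pairs (xs ++ ys))
    ≡⟨ cong₂ _+_ (trans (count-map q (x ,_) (xs ++ ys)) (count-++ _ xs ys)) (count-pairs-++ q xs ys) ⟩
  (a + b) + (c + d + e)
    ≡⟨ solve 5 (λ a b c d e → (a :+ b) :+ (c :+ d :+ e) := (a :+ c) :+ d :+ (b :+ e)) refl a b c d e ⟩
  (a + c) + d + (b + e)
    ≡⟨ cong (λ t → t + d + (b + e)) (sym (trans (count-++ q (map (x ,_) xs) (pairs xs)) (cong (_+ c) (count-map q (x ,_) xs)))) ⟩
  count q (map (x ,_) xs ++ pairs xs) + d + (b + e) ∎
  where
  a = count (λ y → q (x , y)) xs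
  b = count (λ y → q (x , y)) ys
  c = count q (pairs xs)
  d = count q (pairs ys)
  e = cross q xs ys

count-pairs-map : {X Y : Set} (q : Y × Y → Bool) (f : X → Y) (xs : List X) →
                  count q (pairs (map f xs)) ≡ count (q ∘ Product.map f f) (pairs xs)
count-pairs-map q f []       = refl
count-pairs-map q f (x ∷ xs) = begin
  count q (map (f x ,_) (map f xs) ++ pairs (map f xs))
    ≡⟨ count-++ q (map (f x ,_) (map f xs)) (pairs (map f xs)) ⟩
  count q (map (f x ,_) (map f xs)) + count q (pairs (map f xs))
    ≡⟨ cong₂ _+_ (trans (count-map q (f x ,_) (map f xs)) (trans (count-map _ f xs) (sym (count-map _ (x ,_) xs))))
                 (count-pairs-map q f xs) ⟩
  count (q ∘ Product.map f f) (map (x ,_) xs) + count (q ∘ Product.map f f) (pairs xs)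
    ≡⟨ sym (count-++ _ (map (x ,_) xs) (pairs xs)) ⟩
  count (q ∘ Product.map f f) (map (x ,_) xs ++ pairs xs) ∎

cross-map : {X Y : Set} (q : Y × Y → Bool) (f g : X → Y) (xs ys : List X) →
            cross q (map f xs) (map g ys) ≡ cross (q ∘ Product.map f g) xs ys
cross-map q f g []       ys = refl
cross-map q f g (x ∷ xs) ys = cong₂ _+_ (count-map _ g ys) (cross-map q f g xs ys)

adjacent : {n : ℕ} → Vec Bool n × Vec Bool n → Bool
adjacent (u , v) = hamming u v ≡ᵇ 1

edgesWithin : {n : ℕ} → (Vec Bool n → Bool) → ℕ
edgesWithin {n} p = count (within p adjacent) (pairs (allWords n))

count-allWords-suc : {n : ℕ} (p : Vec Bool (suc n) → Bool) →
  count p (allWords (suc n)) ≡ count (p ∘ (false ∷_)) (allWords n) + count (p ∘ (true ∷_)) (allWords n)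
count-allWords-suc {n} p =
  trans (count-++ p (map (false ∷_) (allWords n)) (map (true ∷_) (allWords n)))
        (cong₂ _+_ (count-map p (false ∷_) (allWords n)) (count-map p (true ∷_) (allWords n)))

count-hamming≡0 : {n : ℕ} (x : Vec Bool n) (p : Vec Bool n → Bool) →
                  count (λ y → p y ∧ (hamming x y ≡ᵇ 0)) (allWords n) ≡ (if p x then 1 else 0)
count-hamming≡0 [] p with p []
... | true  = refl
... | false = refl
count-hamming≡0 {suc n} (false ∷ x) p = begin
  count (λ y → p y ∧ (hamming (false ∷ x) y ≡ᵇ 0)) (allWords (suc n))
    ≡⟨ count-allWords-suc (λ y → p y ∧ (hamming (false ∷ x) y ≡ᵇ 0)) ⟩
  count (λ y → p (false ∷ y) ∧ (hamming x y ≡ᵇ 0)) (allWords n) + count (λ y → p (true ∷ y) ∧ false) (allWords n)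
    ≡⟨ cong₂ _+_ (count-hamming≡0 x (p ∘ (false ∷_))) (count-none (λ y → ∧-zeroʳ (p (true ∷ y))) (allWords n)) ⟩
  (if p (false ∷ x) then 1 else 0) + 0
    ≡⟨ +-identityʳ _ ⟩
  (if p (false ∷ x) then 1 else 0) ∎
count-hamming≡0 {suc n} (true ∷ x) p = begin
  count (λ y → p y ∧ (hamming (true ∷ x) y ≡ᵇ 0)) (allWords (suc n))
    ≡⟨ count-allWords-suc (λ y → p y ∧ (hamming (true ∷ x) y ≡ᵇ 0)) ⟩
  count (λ y → p (false ∷ y) ∧ false) (allWords n) + count (λ y → p (true ∷ y) ∧ (hamming x y ≡ᵇ 0)) (allWords n)
    ≡⟨ cong₂ _+_ (count-none (λ y → ∧-zeroʳ (p (false ∷ y))) (allWords n)) (count-hamming≡0 x (p ∘ (true ∷_))) ⟩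
  (if p (true ∷ x) then 1 else 0) ∎

cross-hamming≡0 : {n : ℕ} (p q : Vec Bool n → Bool) (xs : List (Vec Bool n)) →
  cross (λ (u , v) → p u ∧ q v ∧ (hamming u v ≡ᵇ 0)) xs (allWords n) ≡ count (λ x → p x ∧ q x) xs
cross-hamming≡0 p q [] = refl
cross-hamming≡0 {n} p q (x ∷ xs) with p x
... | false = cong₂ _+_ (count-none (λ y → refl) (allWords n)) (cross-hamming≡0 p q xs)
... | true  = trans (cong₂ _+_ (count-hamming≡0 x q) (cross-hamming≡0 p q xs)) (one-if (q x))
  where
  one-if : (b : Bool) → (if b then 1 else 0) + count (λ x → p x ∧ q x) xs
                        ≡ (if b then suc (count (λ x → p x ∧ q x) xs) else count (λ x → p x ∧ q x) xs)
  one-if true  = refl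
  one-if false = refl

-- The edges in the first coordinate direction join 0u to 1u.
edgesWithin-suc : {n : ℕ} (p : Vec Bool (suc n) → Bool) →
  edgesWithin p ≡ edgesWithin (p ∘ (false ∷_)) + edgesWithin (p ∘ (true ∷_))
                  + count (λ u → p (false ∷ u) ∧ p (true ∷ u)) (allWords n)
edgesWithin-suc {n} p = begin
  edgesWithin p
    ≡⟨ count-pairs-++ q (map (false ∷_) (allWords n)) (map (true ∷_) (allWords n)) ⟩
  count q (pairs (map (false ∷_) (allWords n))) + count q (pairs (map (true ∷_) (allWords n)))
    + cross q (map (false ∷_) (allWords n)) (map (true ∷_) (allWords n))
    ≡⟨ cong₂ (λ a b → a + b + cross q (map (false ∷_) (allWords n)) (map (true ∷_) (allWords n)))
             (count-pairs-map q (false ∷_) (allWords n)) (count-pairs-map q (true ∷_) (allWords n)) ⟩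
  edgesWithin (p ∘ (false ∷_)) + edgesWithin (p ∘ (true ∷_))
    + cross q (map (false ∷_) (allWords n)) (map (true ∷_) (allWords n))
    ≡⟨ cong (edgesWithin (p ∘ (false ∷_)) + edgesWithin (p ∘ (true ∷_)) +_)
            (trans (cross-map q (false ∷_) (true ∷_) (allWords n) (allWords n))
                   (cross-hamming≡0 (p ∘ (false ∷_)) (p ∘ (true ∷_)) (allWords n))) ⟩
  edgesWithin (p ∘ (false ∷_)) + edgesWithin (p ∘ (true ∷_))
    + count (λ u → p (false ∷ u) ∧ p (true ∷ u)) (allWords n) ∎
  where
  q : Vec Bool (suc n) × Vec Bool (suc n) → Bool
  q = within p adjacent

-- An automaton recognising run-constrained words

-- `ones k`: inside a run of k+1 ones; `zeros d`: inside the 0-run after such a run,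
-- which must still grow by more than d.
data State : Set where
  free  : State
  ones  : ℕ → State
  zeros : ℕ → State
  dead  : State

step : State → Bool → State
step free            false = free
step free            true  = ones 0
step (ones k)        false = zeros k
step (ones k)        true  = ones (suc k)
step (zeros _)       true  = dead
step (zeros zero)    false = free
step (zeros (suc d)) false = zeros d
step dead            _     = dead

runsOKFrom : State → List (Bool × ℕ) → Bool
runsOKFrom free      rs                 = runsOK rs
runsOKFrom (ones k)  []                 = false
runsOKFrom (ones k)  ((true , j) ∷ rs)  = runsOK ((true , suc k + j) ∷ rs)
runsOKFrom (ones k)  ((false , m) ∷ rs) = runsOK ((true , suc k) ∷ (false , m) ∷ rs)
runsOKFrom (zeros d) []                 = false
runsOKFrom (zeros d) ((true , _) ∷ rs)  = false
runsOKFrom (zeros d) ((false , m) ∷ rs) = (d <ᵇ m) ∧ runsOK rs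
runsOKFrom dead      _                  = false

-- Acceptance of w followed by the two padding zeros.
accepts : State → List Bool → Bool
accepts s []      = runsOKFrom s ((false , 2) ∷ [])
accepts s (b ∷ w) = accepts (step s b) w

runs-∷≢[] : ∀ b w → runs (b ∷ w) ≢ []
runs-∷≢[] b w with runs w
... | []           = λ ()
... | (c , k) ∷ rs with b | c
...   | true  | true  = λ ()
...   | true  | false = λ ()
...   | false | true  = λ ()
...   | false | false = λ ()

runsOKFrom-∷ : ∀ s b w → runs w ≢ [] → runsOKFrom s (runs (b ∷ w)) ≡ runsOKFrom (step s b) (runs w)
runsOKFrom-∷ s b w w≢[] with runs w
... | [] = ⊥-elim (w≢[] refl)
runsOKFrom-∷ free            true  w _ | (true  , j) ∷ rs = refl
runsOKFrom-∷ free            true  w _ | (false , j) ∷ rs = refl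
runsOKFrom-∷ free            false w _ | (true  , j) ∷ rs = refl
runsOKFrom-∷ free            false w _ | (false , j) ∷ rs = refl
runsOKFrom-∷ (ones k)        true  w _ | (true  , j) ∷ rs rewrite +-suc k j = refl
runsOKFrom-∷ (ones k)        true  w _ | (false , j) ∷ rs rewrite +-suc k 0 | +-identityʳ k = refl
runsOKFrom-∷ (ones k)        false w _ | (true  , j) ∷ rs = refl
runsOKFrom-∷ (ones k)        false w _ | (false , j) ∷ rs = refl
runsOKFrom-∷ (zeros d)       true  w _ | (true  , j) ∷ rs = refl
runsOKFrom-∷ (zeros d)       true  w _ | (false , j) ∷ rs = refl
runsOKFrom-∷ (zeros zero)    false w _ | (true  , j) ∷ rs = refl
runsOKFrom-∷ (zeros (suc d)) false w _ | (true  , j) ∷ rs = refl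
runsOKFrom-∷ (zeros zero)    false w _ | (false , j) ∷ rs = refl
runsOKFrom-∷ (zeros (suc d)) false w _ | (false , j) ∷ rs = refl
runsOKFrom-∷ dead            b     w _ | (c , j) ∷ rs = refl

padded : List Bool → List Bool
padded w = w ++ false ∷ false ∷ []

runs-padded≢[] : ∀ w → runs (padded w) ≢ []
runs-padded≢[] []      = runs-∷≢[] false (false ∷ [])
runs-padded≢[] (b ∷ w) = runs-∷≢[] b (padded w)

runsOKFrom-padded : ∀ s w → runsOKFrom s (runs (padded w)) ≡ accepts s w
runsOKFrom-padded s []      = refl
runsOKFrom-padded s (b ∷ w) =
  trans (runsOKFrom-∷ s b (padded w) (runs-padded≢[] w)) (runsOKFrom-padded (step s b) w)

accepts? : {n : ℕ} → State → Vec Bool n → Bool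
accepts? s u = accepts s (toList u)

does-≟-true : (b : Bool) → does (b Bool.≟ true) ≡ b
does-≟-true true  = refl
does-≟-true false = refl

numEdges≡edgesWithin : (n : ℕ) → numEdges n ≡ edgesWithin {n} (accepts? free)
numEdges≡edgesWithin n = begin
  numEdges n
    ≡⟨ length-filter (λ (u , v) → hamming u v ℕ.≟ 1) (pairs (vertices n)) ⟩
  count adjacent (pairs (vertices n))
    ≡⟨ count-pairs-filter (λ w → runConstrained? (padded (toList w))) adjacent (allWords n) ⟩
  count (within (λ w → does (runConstrained? (padded (toList w)))) adjacent) (pairs (allWords n))
    ≡⟨ count-≗ (λ (u , v) → cong₂ (λ a b → a ∧ b ∧ adjacent (u , v)) (isVertex u) (isVertex v)) (pairs (allWords n)) ⟩
  edgesWithin {n} (accepts? free) ∎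
  where
  isVertex : (w : Vec Bool n) → does (runConstrained? (padded (toList w))) ≡ accepts? free w
  isVertex w = trans (does-≟-true _) (runsOKFrom-padded free (toList w))

vertexCount : State → ℕ → ℕ
vertexCount s n = count (accepts? {n} s) (allWords n)

commonCount : State → State → ℕ → ℕ
commonCount s t n = count (λ u → accepts? {n} s u ∧ accepts? t u) (allWords n)

edgeCount : State → ℕ → ℕ
edgeCount s n = edgesWithin {n} (accepts? s)

vertexCount-suc : ∀ s n → vertexCount s (suc n) ≡ vertexCount (step s false) n + vertexCount (step s true) n
vertexCount-suc s n = count-allWords-suc {n} (accepts? s)

commonCount-suc : ∀ s t n →
  commonCount s t (suc n) ≡ commonCount (step s false) (step t false) n + commonCount (step s true) (step t true) n
commonCount-suc s t n = count-allWords-suc {n} (λ u → accepts? s u ∧ accepts? t u)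

edgeCount-suc : ∀ s n →
  edgeCount s (suc n) ≡ edgeCount (step s false) n + edgeCount (step s true) n
                        + commonCount (step s false) (step s true) n
edgeCount-suc s n = edgesWithin-suc {n} (accepts? s)

accepts-dead : ∀ w → accepts dead w ≡ false
accepts-dead []      = refl
accepts-dead (b ∷ w) = accepts-dead w

vertexCount-dead : ∀ n → vertexCount dead n ≡ 0
vertexCount-dead n = count-none (accepts-dead ∘ toList) (allWords n)

commonCount-deadˡ : ∀ t n → commonCount dead t n ≡ 0
commonCount-deadˡ t n = count-none (λ u → cong (_∧ accepts? t u) (accepts-dead (toList u))) (allWords n)

commonCount-deadʳ : ∀ s n → commonCount s dead n ≡ 0
commonCount-deadʳ s n =
  count-none (λ u → trans (cong (accepts? s u ∧_) (accepts-dead (toList u))) (∧-zeroʳ _)) (allWords n)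

edgeCount-dead : ∀ n → edgeCount dead n ≡ 0
edgeCount-dead n =
  count-none (λ (u , v) → cong (λ b → b ∧ accepts? dead v ∧ adjacent (u , v)) (accepts-dead (toList u)))
             (pairs (allWords n))

vertexCount-zeros : ∀ d n → vertexCount (zeros d) (suc n) ≡ vertexCount (step (zeros d) false) n
vertexCount-zeros d n = begin
  vertexCount (zeros d) (suc n)                           ≡⟨ vertexCount-suc (zeros d) n ⟩
  vertexCount (step (zeros d) false) n + vertexCount dead n ≡⟨ cong (vertexCount (step (zeros d) false) n +_) (vertexCount-dead n) ⟩
  vertexCount (step (zeros d) false) n + 0                ≡⟨ +-identityʳ _ ⟩
  vertexCount (step (zeros d) false) n                    ∎

edgeCount-zeros : ∀ d n → edgeCount (zeros d) (suc n) ≡ edgeCount (step (zeros d) false) n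
edgeCount-zeros d n = begin
  edgeCount (zeros d) (suc n)
    ≡⟨ edgeCount-suc (zeros d) n ⟩
  edgeCount (step (zeros d) false) n + edgeCount dead n + commonCount (step (zeros d) false) dead n
    ≡⟨ cong₂ (λ a b → edgeCount (step (zeros d) false) n + a + b) (edgeCount-dead n) (commonCount-deadʳ _ n) ⟩
  edgeCount (step (zeros d) false) n + 0 + 0
    ≡⟨ trans (+-identityʳ _) (+-identityʳ _) ⟩
  edgeCount (step (zeros d) false) n ∎

-- Language inclusion between states

infix 4 _≼_
data _≼_ : State → State → Set where
  ≼-refl      : ∀ {s} → s ≼ s
  dead≼       : ∀ {s} → dead ≼ s
  zeros≼free  : ∀ {d} → zeros d ≼ free
  zeros≼zeros : ∀ {d e} → e ≤ d → zeros d ≼ zeros e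
  ones≼free   : ∀ {k} → ones k ≼ free
  ones≼ones   : ∀ {j k} → j ≤ k → ones k ≼ ones j

step-mono : ∀ {t s} → t ≼ s → ∀ b → step t b ≼ step s b
step-mono ≼-refl                            b     = ≼-refl
step-mono dead≼                             b     = dead≼
step-mono zeros≼free                        true  = dead≼
step-mono (zeros≼free {zero})               false = ≼-refl
step-mono (zeros≼free {suc d})              false = zeros≼free
step-mono (zeros≼zeros e≤d)                 true  = dead≼
step-mono (zeros≼zeros {zero}  z≤n)         false = ≼-refl
step-mono (zeros≼zeros {suc d} z≤n)         false = zeros≼free
step-mono (zeros≼zeros {suc d} (s≤s e≤d))   false = zeros≼zeros e≤d
step-mono ones≼free                         false = zeros≼free
step-mono ones≼free                         true  = ones≼ones z≤n
step-mono (ones≼ones j≤k)                   false = zeros≼zeros j≤k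
step-mono (ones≼ones j≤k)                   true  = ones≼ones (s≤s j≤k)

accepts-[]-mono : ∀ {t s} → t ≼ s → accepts t [] ≡ true → accepts s [] ≡ true
accepts-[]-mono ≼-refl                                        acc = acc
accepts-[]-mono dead≼                                         ()
accepts-[]-mono zeros≼free                                    acc = refl
accepts-[]-mono (zeros≼zeros {zero}        z≤n)               acc = acc
accepts-[]-mono (zeros≼zeros {suc zero}    z≤n)               acc = refl
accepts-[]-mono (zeros≼zeros {suc zero}    (s≤s z≤n))         acc = acc
accepts-[]-mono (zeros≼zeros {suc (suc d)} z≤n)               acc = refl
accepts-[]-mono (zeros≼zeros {suc (suc d)} (s≤s z≤n))         acc = refl
accepts-[]-mono (zeros≼zeros {suc (suc d)} (s≤s (s≤s e≤d)))   ()
accepts-[]-mono ones≼free                                     acc = refl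
accepts-[]-mono (ones≼ones {k = zero}  z≤n)                   acc = acc
accepts-[]-mono (ones≼ones {k = suc k} j≤k)                   ()

accepts-mono : ∀ {t s} → t ≼ s → ∀ w → accepts t w ≡ true → accepts s w ≡ true
accepts-mono t≼s []      = accepts-[]-mono t≼s
accepts-mono t≼s (b ∷ w) = accepts-mono (step-mono t≼s b) w

commonCount-≼ : ∀ {t s} → t ≼ s → ∀ n → commonCount s t n ≡ vertexCount t n
commonCount-≼ {t} {s} t≼s n = count-≗ both (allWords n)
  where
  both : (u : Vec Bool n) → (accepts? s u ∧ accepts? t u) ≡ accepts? t u
  both u with accepts t (toList u) in acc
  ... | true rewrite accepts-mono t≼s (toList u) acc = refl
  ... | false = ∧-zeroʳ _

vertexCount-ones-suc : ∀ k n → vertexCount (ones (suc k)) (suc n) ≡ vertexCount (ones k) n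
vertexCount-ones-suc zero    zero    = refl
vertexCount-ones-suc (suc k) zero    = refl
vertexCount-ones-suc k       (suc n) =
  trans (vertexCount-suc (ones (suc k)) (suc n))
        (trans (cong₂ _+_ (vertexCount-zeros (suc k) n) (vertexCount-ones-suc (suc k) n))
               (sym (vertexCount-suc (ones k) n)))

vertexCount-free  : ∀ n → vertexCount free n ≡ fib (2 + n)
vertexCount-ones0 : ∀ n → vertexCount (ones 0) n ≡ fib (1 + n)

vertexCount-free zero          = refl
vertexCount-free (suc zero)    = refl
vertexCount-free (suc (suc n)) =
  trans (vertexCount-suc free (suc n)) (cong₂ _+_ (vertexCount-free (suc n)) (vertexCount-ones0 (suc n)))

vertexCount-ones0 zero          = refl
vertexCount-ones0 (suc zero)    = refl
vertexCount-ones0 (suc (suc n)) =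
  trans (vertexCount-suc (ones 0) (suc n))
        (cong₂ _+_ (trans (vertexCount-zeros 0 n) (vertexCount-free n))
                   (trans (vertexCount-ones-suc 0 n) (vertexCount-ones0 n)))

vertexCount-zeros0 : ∀ n → vertexCount (zeros 0) n ≡ fib (1 + n)
vertexCount-zeros0 zero    = refl
vertexCount-zeros0 (suc n) = trans (vertexCount-zeros 0 n) (vertexCount-free n)

zeros-suc≼step : ∀ k → zeros (suc k) ≼ step (zeros k) false
zeros-suc≼step zero    = zeros≼free
zeros-suc≼step (suc k) = zeros≼zeros (m≤n+m k 2)

-- A word accepted from both `zeros k` and `ones (suc k)` starts with 0 and then
-- must pay the larger debt.
commonCount-zeros-ones : ∀ k n → commonCount (zeros k) (ones (suc k)) n ≡ vertexCount (zeros (suc (suc k))) n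
commonCount-zeros-ones zero          zero    = refl
commonCount-zeros-ones (suc zero)    zero    = refl
commonCount-zeros-ones (suc (suc k)) zero    = refl
commonCount-zeros-ones k             (suc n) = begin
  commonCount (zeros k) (ones (suc k)) (suc n)
    ≡⟨ commonCount-suc (zeros k) (ones (suc k)) n ⟩
  commonCount (step (zeros k) false) (zeros (suc k)) n + commonCount dead (ones (suc (suc k))) n
    ≡⟨ cong₂ _+_ (commonCount-≼ (zeros-suc≼step k) n) (commonCount-deadˡ _ n) ⟩
  vertexCount (zeros (suc k)) n + 0
    ≡⟨ +-identityʳ _ ⟩
  vertexCount (zeros (suc k)) n
    ≡⟨ sym (vertexCount-zeros (suc (suc k)) n) ⟩
  vertexCount (zeros (suc (suc k))) (suc n) ∎

edgeCount-ones-suc : ∀ k n → edgeCount (ones (suc k)) (suc n) ≡ edgeCount (ones k) n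
edgeCount-ones-suc zero          zero    = refl
edgeCount-ones-suc (suc zero)    zero    = refl
edgeCount-ones-suc (suc (suc k)) zero    = refl
edgeCount-ones-suc k             (suc n) = begin
  edgeCount (ones (suc k)) (suc (suc n))
    ≡⟨ edgeCount-suc (ones (suc k)) (suc n) ⟩
  edgeCount (zeros (suc k)) (suc n) + edgeCount (ones (suc (suc k))) (suc n)
    + commonCount (zeros (suc k)) (ones (suc (suc k))) (suc n)
    ≡⟨ cong₂ _+_ (cong₂ _+_ (edgeCount-zeros (suc k) n) (edgeCount-ones-suc (suc k) n)) common ⟩
  edgeCount (zeros k) n + edgeCount (ones (suc k)) n + commonCount (zeros k) (ones (suc k)) n
    ≡⟨ sym (edgeCount-suc (ones k) n) ⟩
  edgeCount (ones k) (suc n) ∎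
  where
  common : commonCount (zeros (suc k)) (ones (suc (suc k))) (suc n) ≡ commonCount (zeros k) (ones (suc k)) n
  common = trans (commonCount-zeros-ones (suc k) (suc n))
                 (trans (vertexCount-zeros (suc (suc (suc k))) n) (sym (commonCount-zeros-ones k n)))

edgeCount-free-suc : ∀ n → edgeCount free (suc n) ≡ edgeCount free n + edgeCount (ones 0) n + fib (1 + n)
edgeCount-free-suc n =
  trans (edgeCount-suc free n)
        (cong (edgeCount free n + edgeCount (ones 0) n +_) (trans (commonCount-≼ ones≼free n) (vertexCount-ones0 n)))

edgeCount-ones0 : ∀ n → edgeCount (ones 0) (3 + n) ≡ edgeCount free (1 + n) + edgeCount (ones 0) (1 + n) + fib (1 + n)
edgeCount-ones0 n =
  trans (edgeCount-suc (ones 0) (2 + n))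
        (cong₂ _+_ (cong₂ _+_ (edgeCount-zeros 0 (1 + n)) (edgeCount-ones-suc 0 (1 + n))) common)
  where
  common : commonCount (zeros 0) (ones 1) (2 + n) ≡ fib (1 + n)
  common = begin
    commonCount (zeros 0) (ones 1) (2 + n) ≡⟨ commonCount-zeros-ones 0 (2 + n) ⟩
    vertexCount (zeros 2) (2 + n)          ≡⟨ vertexCount-zeros 2 (1 + n) ⟩
    vertexCount (zeros 1) (1 + n)          ≡⟨ vertexCount-zeros 1 n ⟩
    vertexCount (zeros 0) n                ≡⟨ vertexCount-zeros0 n ⟩
    fib (1 + n)                            ∎

edgeCount-free-recurrence : ∀ n →
  edgeCount free (4 + n) ≡ edgeCount free (3 + n) + edgeCount free (2 + n) + fib (3 + n) + fib (1 + n)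
edgeCount-free-recurrence n = begin
  edgeCount free (4 + n)
    ≡⟨ edgeCount-free-suc (3 + n) ⟩
  e₃ + edgeCount (ones 0) (3 + n) + (f₃ + f₂)
    ≡⟨ cong (λ t → e₃ + t + (f₃ + f₂)) (edgeCount-ones0 n) ⟩
  e₃ + (e₁ + o₁ + f₁) + (f₃ + f₂)
    ≡⟨ solve 6 (λ e₃ e₁ o₁ f₁ f₂ f₃ → e₃ :+ (e₁ :+ o₁ :+ f₁) :+ (f₃ :+ f₂) := e₃ :+ (e₁ :+ o₁ :+ f₂) :+ f₃ :+ f₁)
             refl e₃ e₁ o₁ f₁ f₂ f₃ ⟩
  e₃ + (e₁ + o₁ + f₂) + f₃ + f₁
    ≡⟨ cong (λ t → e₃ + t + f₃ + f₁) (sym (edgeCount-free-suc (1 + n))) ⟩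
  e₃ + edgeCount free (2 + n) + f₃ + f₁ ∎
  where
  e₃ = edgeCount free (3 + n)
  e₁ = edgeCount free (1 + n)
  o₁ = edgeCount (ones 0) (1 + n)
  f₁ = fib (1 + n)
  f₂ = fib (2 + n)
  f₃ = fib (3 + n)

lemma4p2 : (n : ℕ) → 4 ≤ n →
    numEdges n ≡ numEdges (n ∸ 1) + numEdges (n ∸ 2) + fib (n ∸ 1) + fib (n ∸ 3)
lemma4p2 (suc (suc (suc (suc n)))) (s≤s (s≤s (s≤s (s≤s _)))) = begin
  numEdges (4 + n)
    ≡⟨ numEdges≡edgesWithin (4 + n) ⟩
  edgeCount free (4 + n)
    ≡⟨ edgeCount-free-recurrence n ⟩
  edgeCount free (3 + n) + edgeCount free (2 + n) + fib (3 + n) + fib (1 + n)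
    ≡⟨ cong₂ (λ a b → a + b + fib (3 + n) + fib (1 + n))
             (sym (numEdges≡edgesWithin (3 + n))) (sym (numEdges≡edgesWithin (2 + n))) ⟩
  numEdges (3 + n) + numEdges (2 + n) + fib (3 + n) + fib (1 + n) ∎
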